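{- Let $\mathcal{K}$ be a class of multi-sorted structures (in some fixed signature) having a designated sort $S$, and fix $n\in\mathbb{N}$. Let $\mathcal{A}$ be the class of all multi-sorted structures $A$ obtained from some member of $\mathcal{K}$ by adjoining a new sort $L$ carrying a lattice structure (operations $\cdot$ and $+$) and a relation $\rho\subseteq S\times S\times L$ (the only relation or operation connecting $L$ with the other sorts) such that, writing $\varepsilon(a):=\{(x,y)\mid x,y\in S,\ \rho(x,y,a)\}$ for $a\in L$: (1) $\varepsilon(a)$ is an equivalence relation on $S$ for each $a\in L$; (2) $a\mapsto\varepsilon(a)$ is injective; (3) $\varepsilon(a\cdot b)=\varepsilon(a)\cap\varepsilon(b)$ for all $a,b\in L$; (4) $\varepsilon(a+b)=\varepsilon(a)\bowtie_n\varepsilon(b)$ for all $a,b\in L$. Let $\mathcal{A}|L$ be the class of all lattices $A|L$ (the sort $L$ of $A$ with its lattice structure), $A\in\mathcal{A}$. Then $\mathcal{A}|L$ is closed under formation of sublattices.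
   Context: For equivalence relations $\alpha,\beta$ on $S$, $\alpha\bowtie_n\beta=\alpha\circ\beta\circ\alpha\circ\cdots$ denotes the $n$-termed relational product alternating $\alpha$ and $\beta$. For $A\in\mathcal{A}$, $A^-$ denotes the structure obtained by removing the sort $L$ and the relation $\rho$; so $\mathcal{K}$ plays the role of $\mathcal{A}^-=\{A^-\mid A\in\mathcal{A}\}$. -}

module Defs where

open import Level using (Level; suc; _⊔_)
open import Data.Nat using (ℕ; zero)
import Data.Nat as N
open import Data.Product using (Σ; ∃; _×_; _,_)
open import Relation.Binary.PropositionalEquality using (_≡_)
open import Relation.Binary using (IsEquivalence)
open import Algebra.Lattice.Structures using (IsLattice)
open import Function using (_⇔_)
open import Function.Definitions using (Injective)

record LatticeStr (ℓ : Level) : Set (suc ℓ) where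
  field
    Carrier   : Set ℓ
    _·_       : Carrier → Carrier → Carrier
    _+_       : Carrier → Carrier → Carrier
    isLattice : IsLattice _≡_ _+_ _·_

open LatticeStr public

BRel : ∀ {ℓ} → Set ℓ → Set (suc ℓ)
BRel {ℓ} X = X → X → Set ℓ

_≐_ : ∀ {ℓ} {X : Set ℓ} → BRel X → BRel X → Set ℓ
α ≐ β = ∀ x y → (α x y ⇔ β x y)

_∩_ : ∀ {ℓ} {X : Set ℓ} → BRel X → BRel X → BRel X
(α ∩ β) x y = α x y × β x y

_∘ʳ_ : ∀ {ℓ} {X : Set ℓ} → BRel X → BRel X → BRel X
(α ∘ʳ β) x z = ∃ λ y → α x y × β y z

-- α ⋈ₙ β = α ∘ β ∘ α ∘ ⋯ (n factors); 0 factors = identity relation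
⋈ : ∀ {ℓ} {X : Set ℓ} → ℕ → BRel X → BRel X → BRel X
⋈ zero α β x y = x ≡ y
⋈ (N.suc zero) α β = α
⋈ (N.suc (N.suc m)) α β = α ∘ʳ ⋈ (N.suc m) β α

-- Members of 𝒜: a member B of 𝒦 (abstract class of structures with a
-- designated sort S), together with a new lattice sort L and ρ ⊆ S×S×L.
record 𝒜Member {s k ℓ : Level} (Struct : Set s) (S : Struct → Set ℓ)
               (𝒦 : Struct → Set k) (n : ℕ) : Set (s ⊔ k ⊔ suc ℓ) where
  field
    base  : Struct
    inK   : 𝒦 base
    L     : LatticeStr ℓ
    ρ     : S base → S base → Carrier L → Set ℓ
  ε : Carrier L → BRel (S base)
  ε a x y = ρ x y a
  field
    ε-equiv : ∀ a → IsEquivalence (ε a)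
    ε-inj   : ∀ a b → ε a ≐ ε b → a ≡ b
    ε-meet  : ∀ a b → ε (_·_ L a b) ≐ (ε a ∩ ε b)
    ε-join  : ∀ a b → ε (_+_ L a b) ≐ ⋈ n (ε a) (ε b)

open 𝒜Member public

record IsLatticeHom {ℓ₁ ℓ₂} (M : LatticeStr ℓ₁) (N : LatticeStr ℓ₂)
                    (f : Carrier M → Carrier N) : Set (ℓ₁ ⊔ ℓ₂) where
  field
    pres-· : ∀ a b → f (_·_ M a b) ≡ _·_ N (f a) (f b)
    pres-+ : ∀ a b → f (_+_ M a b) ≡ _+_ N (f a) (f b)

-- Sublattice of N (up to isomorphism): a lattice with an injective homomorphism into N
record Sublattice {ℓ₁ ℓ₂} (M : LatticeStr ℓ₁) (N : LatticeStr ℓ₂) : Set (ℓ₁ ⊔ ℓ₂) where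
  field
    emb     : Carrier M → Carrier N
    isHom   : IsLatticeHom M N emb
    emb-inj : Injective _≡_ _≡_ emb

record LatticeIso {ℓ₁ ℓ₂} (M : LatticeStr ℓ₁) (N : LatticeStr ℓ₂) : Set (ℓ₁ ⊔ ℓ₂) where
  field
    to    : Carrier M → Carrier N
    from  : Carrier N → Carrier M
    isHom : IsLatticeHom M N to
    to∘from : ∀ b → to (from b) ≡ b
    from∘to : ∀ a → from (to a) ≡ a

-- M belongs to the class 𝒜|L (closed under isomorphism)
In𝒜L : ∀ {s k ℓ} (Struct : Set s) (S : Struct → Set ℓ) (𝒦 : Struct → Set k)
       (n : ℕ) → LatticeStr ℓ → Set (s ⊔ k ⊔ suc ℓ)
In𝒜L Struct S 𝒦 n M = Σ (𝒜Member Struct S 𝒦 n) λ A → LatticeIso (L A) M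

{-# OPTIONS --safe #-}
module Submission where

open import Defs
open import Level using (Level)
open import Data.Nat using (ℕ)
open import Data.Product using (_,_)
open import Relation.Binary.PropositionalEquality using (refl; sym; subst)

idLatticeIso : ∀ {ℓ} (M : LatticeStr ℓ) → LatticeIso M M
idLatticeIso M = record
  { to      = λ a → a
  ; from    = λ a → a
  ; isHom   = record { pres-· = λ _ _ → refl ; pres-+ = λ _ _ → refl }
  ; to∘from = λ _ → refl
  ; from∘to = λ _ → refl
  }

module _ {s k ℓ} {Struct : Set s} {S : Struct → Set ℓ} {𝒦 : Struct → Set k} {n : ℕ} where

  -- The new ε is definitionally ε A ∘ emb, so (3) and (4) are just transported
  -- along the homomorphism equations of emb.
  restrictToSublattice : (A : 𝒜Member Struct S 𝒦 n) {M : LatticeStr ℓ} →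
                         Sublattice M (L A) → 𝒜Member Struct S 𝒦 n
  restrictToSublattice A {M} sub = record
    { base    = base A
    ; inK     = inK A
    ; L       = M
    ; ρ       = λ x y a → ρ A x y (emb a)
    ; ε-equiv = λ a → ε-equiv A (emb a)
    ; ε-inj   = λ a b εa≐εb → emb-inj (ε-inj A (emb a) (emb b) εa≐εb)
    ; ε-meet  = λ a b → subst (λ c → ε A c ≐ (ε A (emb a) ∩ ε A (emb b)))
                              (sym (pres-· a b)) (ε-meet A (emb a) (emb b))
    ; ε-join  = λ a b → subst (λ c → ε A c ≐ ⋈ n (ε A (emb a)) (ε A (emb b)))
                              (sym (pres-+ a b)) (ε-join A (emb a) (emb b))
    }
    where
    open Sublattice sub
    open IsLatticeHom isHom

fact1 : ∀ {s k ℓ : Level} (Struct : Set s) (S : Struct → Set ℓ) (𝒦 : Struct → Set k)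
          (n : ℕ) (A : 𝒜Member Struct S 𝒦 n) (M : LatticeStr ℓ) →
          Sublattice M (L A) → In𝒜L Struct S 𝒦 n M
fact1 Struct S 𝒦 n A M sub = restrictToSublattice A sub , idLatticeIso M
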